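{- Let $p=4k+1$ be a prime and let $t\ge 0$ be an integer. If $k+1+t$ has a positive divisor $w$ with $w\equiv -1\pmod{3+4t}$, then $0\le t\le \left\lfloor\frac{k-1}{3}\right\rfloor$. -}

module Defs where

{-# OPTIONS --safe #-}
-- Since 3 + 4t divides w + 1 and w divides k + 1 + t, comparing sizes gives
-- 3 + 4t ≤ w + 1 ≤ k + 2 + t, that is 3t ≤ k − 1.
module Submission where

open import Defs
open import Data.Nat using (ℕ; suc; _+_; _*_; _∸_; _≤_; _<_; s≤s; NonZero)
open import Data.Nat.DivMod using (_/_; m*n/n≡m; /-monoˡ-≤)
open import Data.Nat.Divisibility using (_∣_; ∣⇒≤)
open import Data.Nat.Primality using (Prime)
open import Data.Nat.Properties
  using (≤-trans; +-comm; +-assoc; +-suc; +-cancelʳ-≤; m+n≤o⇒m≤o∸n)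
open import Data.Nat.Tactic.RingSolver using (solve-∀)
open import Data.Product using (_×_; ∃-syntax; _,_)
open import Relation.Binary.PropositionalEquality using (_≡_; subst; subst₂; trans)

m*n≤o⇒m≤o/n : ∀ m {n o} .{{_ : NonZero n}} → m * n ≤ o → m ≤ o / n
m*n≤o⇒m≤o/n m {n} m*n≤o = subst (_≤ _ / n) (m*n/n≡m m n) (/-monoˡ-≤ n m*n≤o)

d∣1+w⇒w∣1+n⇒d≤2+n : ∀ {d w n} → d ∣ suc w → w ∣ suc n → d ≤ suc (suc n)
d∣1+w⇒w∣1+n⇒d≤2+n d∣1+w w∣1+n = ≤-trans (∣⇒≤ d∣1+w) (s≤s (∣⇒≤ w∣1+n))

3+4t≤2+k+t⇒t*3≤k∸1 : ∀ k t → 3 + 4 * t ≤ 2 + (k + t) → t * 3 ≤ k ∸ 1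
3+4t≤2+k+t⇒t*3≤k∸1 k t le =
  m+n≤o⇒m≤o∸n (t * 3) (+-cancelʳ-≤ (2 + t) (t * 3 + 1) k (subst₂ _≤_ (lhs t) (rhs k t) le))
  where
  lhs : ∀ x → 3 + 4 * x ≡ (x * 3 + 1) + (2 + x)
  lhs = solve-∀
  rhs : ∀ x y → 2 + (x + y) ≡ x + (2 + y)
  rhs = solve-∀

proposition2 : (p k t : ℕ) → p ≡ 4 * k + 1 → Prime p →
    (∃[ w ] (0 < w × w ∣ (k + 1 + t) × (3 + 4 * t) ∣ (w + 1))) →
    t ≤ (k ∸ 1) / 3
proposition2 _ k t _ _ (w , _ , w∣k+1+t , d∣w+1) =
  m*n≤o⇒m≤o/n t (3+4t≤2+k+t⇒t*3≤k∸1 k t 3+4t≤2+k+t)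
  where
  w∣1+k+t : w ∣ suc (k + t)
  w∣1+k+t = subst (w ∣_) (trans (+-assoc k 1 t) (+-suc k t)) w∣k+1+t
  d∣1+w : 3 + 4 * t ∣ suc w
  d∣1+w = subst (3 + 4 * t ∣_) (+-comm w 1) d∣w+1
  3+4t≤2+k+t : 3 + 4 * t ≤ 2 + (k + t)
  3+4t≤2+k+t = d∣1+w⇒w∣1+n⇒d≤2+n d∣1+w w∣1+k+t
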